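{- Let $\mathbf S$ be a pseudo-model and $H$ the set of histories of its associated model. Let $B,C\subseteq A$ and $h,h'\in H$ with $h\stackrel{\sim}{\to}_Bh'$. Then: (1) $last(h)\sim_Blast(h')$ in $\mathbf S$; (2) $last(h)\in\|B\preceq C\|$ iff $last(h')\in\|B\preceq C\|$; (3) if either of the equivalent conditions in (2) holds, then $h\stackrel{\sim}{\to}_Ch'$.
   Context: Fix a finite set $A$ of agents and a set $Prop$ of atoms. A pseudo-model is $\mathbf S=(S,(\sim_B)_{B\subseteq A},\|\cdot\|)$ with $S$ a set, $\sim_B\subseteq S\times S$, and $\|\cdot\|$ assigning subsets of $S$ to each $p\in Prop$ and each symbol $B\preceq C$ ($B,C\subseteq A$), such that: (1) each $\sim_B$ is an equivalence relation; (2) if $s\in\|B\preceq C\|$ and $s\sim_Bt$ then $s\sim_Ct$ and $t\in\|B\preceq C\|$; (3) $\|B\preceq C\|=S$ if $C\subseteq B$; (4) $\|B\preceq C\|\cap\|B\preceq E\|\subseteq\|B\preceq C\cup E\|$; (5) $\|B\preceq C\|\cap\|C\preceq E\|\subseteq\|B\preceq E\|$. Histories: $H$ is the set of all finite sequences $h=(s_0,B^1,s_1,\dots,B^n,s_n)$ with $n\ge0$, $s_k\in S$, $B^k\subseteq A$, $s_{k-1}\sim_{B^k}s_k$; $last(h):=s_n$. Write $h\to_Bh'$ iff $h'=(h,B,s')$ (i.e. $h$ extended by $B,s'$) for some $s'$ with $last(h)\sim_Bs'$. Write $h\stackrel{\sim}{\to}_Bh'$ iff $h\to_{B'}h'$ for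 some $B'\subseteq A$ with $last(h)\in\|B'\preceq B\|$. -}

module Defs where

open import Level using (Level; suc; _⊔_)
open import Data.Nat using (ℕ)
open import Data.Fin.Subset using (Subset; _⊆_; _∪_)
open import Data.Product using (Σ; ∃; _×_; _,_)
open import Relation.Binary.Core using (Rel)
open import Relation.Binary.Structures using (IsEquivalence)
open import Relation.Binary.PropositionalEquality using (_≡_)

-- The finite set A of agents is Fin n; coalitions B ⊆ A are Subset n.
-- Prop is an arbitrary type of atoms.
record PseudoModel (n : ℕ) (Prop : Set) : Set₁ where
  field
    S      : Set
    _∼[_]_ : S → Subset n → S → Set
    val    : Prop → S → Set
    ⟦_≼_⟧  : Subset n → Subset n → S → Set
    -- (1)
    equiv  : ∀ B → IsEquivalence (λ s t → s ∼[ B ] t)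
    -- (2)
    ≼-∼    : ∀ {B C s t} → ⟦ B ≼ C ⟧ s → s ∼[ B ] t → s ∼[ C ] t × ⟦ B ≼ C ⟧ t
    -- (3)
    ≼-sub  : ∀ {B C} → C ⊆ B → ∀ s → ⟦ B ≼ C ⟧ s
    -- (4)
    ≼-∪    : ∀ {B C E s} → ⟦ B ≼ C ⟧ s → ⟦ B ≼ E ⟧ s → ⟦ B ≼ (C ∪ E) ⟧ s
    -- (5)
    ≼-trans : ∀ {B C E s} → ⟦ B ≼ C ⟧ s → ⟦ C ≼ E ⟧ s → ⟦ B ≼ E ⟧ s

module Histories {n : ℕ} {Prop : Set} (M : PseudoModel n Prop) where
  open PseudoModel M

  data Seq : Set where
    start : S → Seq
    _▷_,_ : Seq → Subset n → S → Seq

  last : Seq → S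
  last (start s)   = s
  last (h ▷ B , s) = s

  data IsHistory : Seq → Set where
    start : ∀ s → IsHistory (start s)
    step  : ∀ {h B s} → IsHistory h → last h ∼[ B ] s → IsHistory (h ▷ B , s)

  H : Set
  H = Σ Seq IsHistory

  lastH : H → S
  lastH (h , _) = last h

  _⟶[_]_ : H → Subset n → H → Set
  (h , _) ⟶[ B ] (h' , _) = ∃ λ s' → (last h ∼[ B ] s') × (h' ≡ (h ▷ B , s'))

  _~⟶[_]_ : H → Subset n → H → Set
  h ~⟶[ B ] h' = ∃ λ B' → (h ⟶[ B' ] h') × ⟦ B' ≼ B ⟧ (lastH h)

module Submission where

open import Defs
open import Data.Nat using (ℕ)
open import Data.Fin.Subset using (Subset)
open import Data.Product using (_×_; _,_; proj₁; proj₂)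
open import Data.Sum using (_⊎_; [_,_])
open import Function.Bundles using (_⇔_; mk⇔; Equivalence)
open import Function.Base using (id)
open import Relation.Binary.PropositionalEquality using (refl)
open import Relation.Binary.Structures using (IsEquivalence)

-- A ~→_B move is a ∼_{B'} move with B' ≼ B, hence a ∼_B move by axiom (2); axiom (2)
-- with symmetry of ∼_B then transports ‖B ≼ C‖ both ways, and axiom (5) chains B' ≼ B ≼ C.

module _ {n : ℕ} {Prop : Set} (M : PseudoModel n Prop) where
  open PseudoModel M
  open Histories M

  ≼-weakens-∼ : ∀ {B C s t} → ⟦ B ≼ C ⟧ s → s ∼[ B ] t → s ∼[ C ] t
  ≼-weakens-∼ p r = proj₁ (≼-∼ p r)

  ≼-respects-∼ : ∀ {B C s t} → s ∼[ B ] t → ⟦ B ≼ C ⟧ s ⇔ ⟦ B ≼ C ⟧ t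
  ≼-respects-∼ {B} r =
    mk⇔ (λ q → proj₂ (≼-∼ q r))
        (λ q → proj₂ (≼-∼ q (IsEquivalence.sym (equiv B) r)))

  ~⟶⇒∼ : ∀ {B h h'} → h ~⟶[ B ] h' → lastH h ∼[ B ] lastH h'
  ~⟶⇒∼ {h' = ._ , _} (_ , (_ , r , refl) , p) = ≼-weakens-∼ p r

  ~⟶-weaken : ∀ {B C h h'} → h ~⟶[ B ] h' → ⟦ B ≼ C ⟧ (lastH h) → h ~⟶[ C ] h'
  ~⟶-weaken (B' , move , p) q = B' , move , ≼-trans p q

lemma4 : {n : ℕ} {Prop : Set} (M : PseudoModel n Prop) →
    let open PseudoModel M in
    let open Histories M in
    (B C : Subset n) (h h' : H) → h ~⟶[ B ] h' →
    (lastH h ∼[ B ] lastH h')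
    × (⟦ B ≼ C ⟧ (lastH h) ⇔ ⟦ B ≼ C ⟧ (lastH h'))
    × (⟦ B ≼ C ⟧ (lastH h) ⊎ ⟦ B ≼ C ⟧ (lastH h') → h ~⟶[ C ] h')
lemma4 M B C h h' move = h∼h' , same-≼ , λ q → ~⟶-weaken M {h = h} {h'} move (either-side q)
  where
  open PseudoModel M
  open Histories M
  h∼h' : lastH h ∼[ B ] lastH h'
  h∼h' = ~⟶⇒∼ M {h = h} {h'} move
  same-≼ : ⟦ B ≼ C ⟧ (lastH h) ⇔ ⟦ B ≼ C ⟧ (lastH h')
  same-≼ = ≼-respects-∼ M h∼h'
  either-side : ⟦ B ≼ C ⟧ (lastH h) ⊎ ⟦ B ≼ C ⟧ (lastH h') → ⟦ B ≼ C ⟧ (lastH h)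
  either-side = [ id , Equivalence.from same-≼ ]
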